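{- Let $\mathcal{F}$ be an odd-sunflower-free family of sets, and let $\mathcal{H}$ be a multifamily of size at least two all of whose members belong to $\mathcal{F}$. Then $\mathcal{H}$ is an odd-sunflower multifamily if and only if it consists of an odd number of copies of a single member $F\in\mathcal{F}$ together with an even number of copies of some subsets of $F$ (each such subset being a member of $\mathcal{F}$). In particular, if $|\mathcal{H}|$ (counted with multiplicity) is even, then $\mathcal{H}$ is not an odd-sunflower.
   Context: A family of at least two nonempty sets is an odd-sunflower if every element of the underlying set is contained in an odd number of its sets, or in none; a family is odd-sunflower-free if none of its subfamilies is an odd-sunflower. In a multifamily each set occurs with a positive integer multiplicity; a multifamily of at least two nonempty sets (counted with multiplicity) is an odd-sunflower multifamily if the degree (number of sets containing it, counted with multiplicity) of every element is odd or zero. -}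

module Defs where

open import Data.Nat using (ℕ; _≤_)
open import Data.Nat.Divisibility using (_∣_)
open import Data.Fin using (Fin)
open import Data.Fin.Subset using (Subset; _∈_; Nonempty)
open import Data.Fin.Subset.Properties using (_∈?_)
open import Data.Bool.Properties using () renaming (_≟_ to _≟B_)
open import Data.Vec.Properties using (≡-dec)
open import Data.List using (List; length; filter)
open import Data.List.Relation.Unary.All using (All)
open import Data.List.Relation.Unary.Unique.Propositional using (Unique)
open import Data.List.Relation.Binary.Sublist.Propositional renaming (_⊆_ to _⊑_)
open import Data.Product using (_×_)
open import Data.Sum using (_⊎_)
open import Relation.Binary.PropositionalEquality using (_≡_)
open import Relation.Nullary using (¬_; Dec)

-- Sets are subsets of a finite ground set Fin n.
-- A family of sets is a duplicate-free list of subsets; a multifamily is a list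
-- of subsets (repetitions = multiplicity, order irrelevant).

Even : ℕ → Set
Even m = 2 ∣ m

Odd : ℕ → Set
Odd m = ¬ (2 ∣ m)

_≟S_ : ∀ {n} (S T : Subset n) → Dec (S ≡ T)
_≟S_ = ≡-dec _≟B_

degree : ∀ {n} → Fin n → List (Subset n) → ℕ
degree x H = length (filter (x ∈?_) H)

mult : ∀ {n} → Subset n → List (Subset n) → ℕ
mult S H = length (filter (_≟S S) H)

IsOddSunflower : ∀ {n} → List (Subset n) → Set
IsOddSunflower {n} H =
  (2 ≤ length H) × All Nonempty H × (∀ (x : Fin n) → degree x H ≡ 0 ⊎ Odd (degree x H))

IsFamily : ∀ {n} → List (Subset n) → Set
IsFamily 𝓕 = Unique 𝓕

OddSunflowerFree : ∀ {n} → List (Subset n) → Set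
OddSunflowerFree 𝓕 = ∀ 𝓖 → 𝓖 ⊑ 𝓕 → ¬ IsOddSunflower 𝓖

module Submission where

-- Let G = oddPart 𝓕 H be the members of 𝓕 of odd multiplicity in H. As 𝓕 is repetition-free and
-- contains every member of H, for each decidable property P the number of members of H with P
-- (with multiplicity) is the sum of the multiplicities of the members of 𝓕 with P; hence it is at
-- least, and congruent mod 2 to, the number of members of G with P. Taking P to be "contains x",
-- G has the same parity of degrees as H and no larger degrees. So if H is an odd-sunflower, G is
-- one as soon as |G| ≥ 2, which is impossible as G ⊆ 𝓕; and G ≠ ∅ because some element has odd
-- degree. Thus G = {F}: the elements of odd degree in H are exactly those of F, so every member of
-- H lies in F, and |H| ≡ |G| = 1 (mod 2). Conversely, the right-hand side says precisely that
-- G = {F}, and then every element of F has odd degree while no other element is covered.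

open import Defs
open import Data.Bool using (true; false)
open import Data.Empty using (⊥-elim)
open import Data.Fin using (Fin)
open import Data.Fin.Subset using (Subset; _⊆_; Nonempty) renaming (_∈_ to _∈ₛ_)
open import Data.Fin.Subset.Properties using (_∈?_)
open import Data.List using (List; []; _∷_; [_]; _++_; length; filter; map)
open import Data.List.Properties
  using (filter-accept; filter-reject; filter-all; filter-none; filter-some; filter-++; length-++; map-cong)
open import Data.List.Membership.Propositional using (_∈_; lose)
open import Data.List.Membership.Propositional.Properties using (∈-filter⁺; ∈-filter⁻)
open import Data.List.Relation.Binary.Sublist.Propositional.Properties using (filter-⊆)
open import Data.List.Relation.Unary.All as All using (All; []; _∷_)
open import Data.List.Relation.Unary.All.Properties as All using ()
open import Data.List.Relation.Unary.AllPairs using (_∷_)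
open import Data.List.Relation.Unary.Any using (here; there)
open import Data.List.Relation.Unary.Any.Properties using (singleton⁻)
open import Data.List.Relation.Unary.Unique.Propositional using (Unique)
open import Data.List.Relation.Unary.Unique.Propositional.Properties as Unique using ()
open import Data.Nat using (ℕ; zero; suc; _+_; _≤_; _<_; z≤n; s≤s; parity)
open import Data.Nat.Divisibility using (_∣?_; divides; ∣m∣n⇒∣m+n; ∣-refl)
open import Data.Nat.ListAction using (sum)
open import Data.Nat.Properties
  using (+-mono-≤; m≤n+m; n≤0⇒n≡0; ≤-trans; <⇒≢; +-commutativeSemigroup; module ≤-Reasoning)
open import Algebra.Properties.CommutativeSemigroup +-commutativeSemigroup using (interchange)
open import Data.Parity using (0ℙ; 1ℙ) renaming (_+_ to _+ℙ_)
open import Data.Parity.Properties using (+-homo-+; *-homo-*; *-zeroʳ)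
open import Data.Product using (_×_; ∃-syntax; _,_; proj₂)
open import Data.Sum using (_⊎_; inj₁; inj₂)
open import Function using (_∘_)
open import Function.Bundles using (_⇔_; mk⇔; Equivalence)
open import Level using (Level)
open import Relation.Binary.PropositionalEquality
  using (_≡_; _≢_; refl; sym; trans; cong; cong₂; subst; module ≡-Reasoning)
open import Relation.Nullary using (¬_; Dec; yes; no; does; ¬?)
open import Relation.Nullary.Decidable using (decidable-stable)
open import Relation.Unary using (Pred; Decidable)
open import Relation.Unary.Properties using (U?)

private
  variable
    a p q : Level
    A : Set a

sum-map-+ : ∀ (f g : A → ℕ) xs →
  sum (map (λ x → f x + g x) xs) ≡ sum (map f xs) + sum (map g xs)
sum-map-+ f g []       = refl
sum-map-+ f g (x ∷ xs) =
  trans (cong (f x + g x +_) (sum-map-+ f g xs)) (interchange (f x) (g x) _ _)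

sum-map-0 : ∀ (xs : List A) → sum (map (λ _ → 0) xs) ≡ 0
sum-map-0 []       = refl
sum-map-0 (_ ∷ xs) = sum-map-0 xs

filter-comm : ∀ {P : Pred A p} {Q : Pred A q} (P? : Decidable P) (Q? : Decidable Q) xs →
  filter P? (filter Q? xs) ≡ filter Q? (filter P? xs)
filter-comm P? Q? [] = refl
filter-comm P? Q? (x ∷ xs) with does (P? x) in Px | does (Q? x) in Qx
... | true  | true  rewrite Px | Qx = cong (x ∷_) (filter-comm P? Q? xs)
... | true  | false rewrite Qx      = filter-comm P? Q? xs
... | false | true  rewrite Px      = filter-comm P? Q? xs
... | false | false                 = filter-comm P? Q? xs

filter≡singleton : ∀ {P : Pred A p} (P? : Decidable P) {x xs} → Unique xs → x ∈ xs → P x →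
  (∀ {y} → y ∈ xs → P y → y ≡ x) → filter P? xs ≡ [ x ]
filter≡singleton P? (x∉xs ∷ _) (here refl) Px only-x =
  trans (filter-accept P? Px) (cong (_ ∷_) (filter-none P? (All.tabulate λ y∈xs Py →
    All.lookup x∉xs y∈xs (sym (only-x (there y∈xs) Py)))))
filter≡singleton P? (y∉xs ∷ xs-unique) (there x∈xs) Px only-x =
  trans (filter-reject P? (All.lookup y∉xs x∈xs ∘ only-x (here refl)))
    (filter≡singleton P? xs-unique x∈xs Px (only-x ∘ there))

odd? : ∀ m → Dec (Odd m)
odd? m = ¬? (2 ∣? m)

even⇒parity≡0ℙ : ∀ {m} → Even m → parity m ≡ 0ℙ
even⇒parity≡0ℙ (divides q refl) = trans (*-homo-* q 2) (*-zeroʳ (parity q))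

parity≡0ℙ⇒even : ∀ m → parity m ≡ 0ℙ → Even m
parity≡0ℙ⇒even zero          _  = divides 0 refl
parity≡0ℙ⇒even (suc (suc m)) eq = ∣m∣n⇒∣m+n ∣-refl (parity≡0ℙ⇒even m eq)

odd⇔parity≡1ℙ : ∀ m → Odd m ⇔ parity m ≡ 1ℙ
odd⇔parity≡1ℙ m = mk⇔ to from
  where
  to : Odd m → parity m ≡ 1ℙ
  to odd with parity m in eq
  ... | 1ℙ = refl
  ... | 0ℙ = ⊥-elim (odd (parity≡0ℙ⇒even m eq))
  from : parity m ≡ 1ℙ → Odd m
  from eq even with () ← trans (sym eq) (even⇒parity≡0ℙ even)

odd-1 : Odd 1
odd-1 = Equivalence.from (odd⇔parity≡1ℙ 1) refl

odd⇒>0 : ∀ {m} → Odd m → 0 < m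
odd⇒>0 {zero}  odd = ⊥-elim (odd (divides 0 refl))
odd⇒>0 {suc m} _   = s≤s z≤n

odd-resp-parity : ∀ {m k} → parity m ≡ parity k → Odd m → Odd k
odd-resp-parity {m} {k} eq odd =
  Equivalence.from (odd⇔parity≡1ℙ k) (trans (sym eq) (Equivalence.to (odd⇔parity≡1ℙ m) odd))

parity-sum : ∀ (m : A → ℕ) xs →
  parity (sum (map m xs)) ≡ parity (length (filter (odd? ∘ m) xs))
parity-sum m [] = refl
parity-sum m (x ∷ xs) with odd? (m x)
... | no ¬odd rewrite filter-reject (odd? ∘ m) {xs = xs} ¬odd =
  trans (+-homo-+ (m x) _) (cong₂ _+ℙ_ (even⇒parity≡0ℙ (decidable-stable (2 ∣? m x) ¬odd)) (parity-sum m xs))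
... | yes odd rewrite filter-accept (odd? ∘ m) {xs = xs} odd = begin
  parity (m x + sum (map m xs))                  ≡⟨ +-homo-+ (m x) _ ⟩
  parity (m x) +ℙ parity (sum (map m xs))        ≡⟨ cong₂ _+ℙ_ (Equivalence.to (odd⇔parity≡1ℙ (m x)) odd) (parity-sum m xs) ⟩
  1ℙ +ℙ parity #odd                              ≡⟨ +-homo-+ 1 #odd ⟨
  parity (suc #odd)                              ∎
  where
  open ≡-Reasoning
  #odd = length (filter (odd? ∘ m) xs)

length-filter-odd≤sum : ∀ (m : A → ℕ) xs → length (filter (odd? ∘ m) xs) ≤ sum (map m xs)
length-filter-odd≤sum m [] = z≤n
length-filter-odd≤sum m (x ∷ xs) with odd? (m x)
... | no ¬odd rewrite filter-reject (odd? ∘ m) {xs = xs} ¬odd =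
  ≤-trans (length-filter-odd≤sum m xs) (m≤n+m _ (m x))
... | yes odd rewrite filter-accept (odd? ∘ m) {xs = xs} odd =
  +-mono-≤ (odd⇒>0 odd) (length-filter-odd≤sum m xs)

module _ {n : ℕ} where

  mult-++ : ∀ (T : Subset n) xs ys → mult T (xs ++ ys) ≡ mult T xs + mult T ys
  mult-++ T xs ys = trans (cong length (filter-++ (_≟S T) xs ys)) (length-++ (filter (_≟S T) xs))

  mult>0⇒∈ : ∀ {T : Subset n} H → 0 < mult T H → T ∈ H
  mult>0⇒∈ {T} (h ∷ H) mult>0 with h ≟S T
  ... | yes h≡T = here (sym h≡T)
  ... | no  _   = there (mult>0⇒∈ H mult>0)

  sum-mult-singleton-∉ : ∀ {h : Subset n} {L} → All (h ≢_) L → sum (map (λ T → mult T [ h ]) L) ≡ 0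
  sum-mult-singleton-∉ []          = refl
  sum-mult-singleton-∉ (h≢T ∷ h∉L) =
    cong₂ _+_ (cong length (filter-reject (_≟S _) h≢T)) (sum-mult-singleton-∉ h∉L)

  sum-mult-singleton-∈ : ∀ {h : Subset n} {L} → Unique L → h ∈ L → sum (map (λ T → mult T [ h ]) L) ≡ 1
  sum-mult-singleton-∈ {h} (h∉L ∷ _) (here refl) =
    cong₂ _+_ (cong length (filter-accept (_≟S h) refl)) (sum-mult-singleton-∉ h∉L)
  sum-mult-singleton-∈ (T∉L ∷ L-unique) (there h∈L) =
    cong₂ _+_ (cong length (filter-reject (_≟S _) (All.lookup T∉L h∈L ∘ sym))) (sum-mult-singleton-∈ L-unique h∈L)

  module _ {P : Pred (Subset n) p} (P? : Decidable P) where

    sum-mult-singleton : ∀ {h 𝓕} → Unique 𝓕 → h ∈ 𝓕 →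
      sum (map (λ T → mult T [ h ]) (filter P? 𝓕)) ≡ length (filter P? [ h ])
    sum-mult-singleton {h} {𝓕} 𝓕-unique h∈𝓕 with P? h
    ... | yes Ph = sum-mult-singleton-∈ (Unique.filter⁺ P? 𝓕-unique) (∈-filter⁺ P? h∈𝓕 Ph)
    ... | no ¬Ph = sum-mult-singleton-∉ (All.tabulate λ T∈𝓕ₚ h≡T →
      ¬Ph (subst P (sym h≡T) (proj₂ (∈-filter⁻ P? {xs = 𝓕} T∈𝓕ₚ))))

    length-filter≡sum-mult : ∀ {𝓕 H} → Unique 𝓕 → All (_∈ 𝓕) H →
      length (filter P? H) ≡ sum (map (λ T → mult T H) (filter P? 𝓕))
    length-filter≡sum-mult {𝓕} 𝓕-unique [] = sym (sum-map-0 (filter P? 𝓕))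
    length-filter≡sum-mult {𝓕} {h ∷ H} 𝓕-unique (h∈𝓕 ∷ H⊆𝓕) = begin
      length (filter P? ([ h ] ++ H))
        ≡⟨ cong length (filter-++ P? [ h ] H) ⟩
      length (filter P? [ h ] ++ filter P? H)
        ≡⟨ length-++ (filter P? [ h ]) ⟩
      length (filter P? [ h ]) + length (filter P? H)
        ≡⟨ cong₂ _+_ (sym (sum-mult-singleton 𝓕-unique h∈𝓕)) (length-filter≡sum-mult 𝓕-unique H⊆𝓕) ⟩
      sum (map (λ T → mult T [ h ]) 𝓕ₚ) + sum (map (λ T → mult T H) 𝓕ₚ)
        ≡⟨ sum-map-+ (λ T → mult T [ h ]) (λ T → mult T H) 𝓕ₚ ⟨
      sum (map (λ T → mult T [ h ] + mult T H) 𝓕ₚ)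
        ≡⟨ cong sum (map-cong (λ T → mult-++ T [ h ] H) 𝓕ₚ) ⟨
      sum (map (λ T → mult T (h ∷ H)) 𝓕ₚ) ∎
      where
      open ≡-Reasoning
      𝓕ₚ = filter P? 𝓕

  degree>0 : ∀ {x : Fin n} {S H} → S ∈ H → x ∈ₛ S → 0 < degree x H
  degree>0 {x} S∈H x∈S = filter-some (x ∈?_) (lose S∈H x∈S)

  odd-degree-singleton⇔∈ : ∀ {x : Fin n} {F} → Odd (degree x [ F ]) ⇔ x ∈ₛ F
  odd-degree-singleton⇔∈ {x} {F} = mk⇔ to from
    where
    to : Odd (degree x [ F ]) → x ∈ₛ F
    to odd with x ∈? F
    ... | yes x∈F = x∈F
    ... | no  _   = ⊥-elim (odd (divides 0 refl))
    from : x ∈ₛ F → Odd (degree x [ F ])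
    from x∈F rewrite filter-accept (x ∈?_) {xs = []} x∈F = odd-1

  isOddSunflower⇒odd-degree : ∀ {H S} {x : Fin n} → IsOddSunflower H → S ∈ H → x ∈ₛ S → Odd (degree x H)
  isOddSunflower⇒odd-degree {x = x} (_ , _ , degrees) S∈H x∈S with degrees x
  ... | inj₁ deg≡0 = ⊥-elim (<⇒≢ (degree>0 S∈H x∈S) (sym deg≡0))
  ... | inj₂ odd   = odd

  isOddSunflower⇒∃odd-degree : ∀ {H} → IsOddSunflower H → ∃[ x ] Odd (degree x H)
  isOddSunflower⇒∃odd-degree {S ∷ _} H-odd@(_ , (x , x∈S) ∷ _ , _) =
    x , isOddSunflower⇒odd-degree H-odd (here refl) x∈S

  oddMult? : (H : List (Subset n)) → Decidable (λ T → Odd (mult T H))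
  oddMult? H T = odd? (mult T H)

  oddPart : List (Subset n) → List (Subset n) → List (Subset n)
  oddPart 𝓕 H = filter (oddMult? H) 𝓕

  OddCentre : List (Subset n) → List (Subset n) → Subset n → Set
  OddCentre 𝓕 H F = F ∈ 𝓕 × Odd (mult F H) × (∀ S → S ∈ H → S ⊆ F) ×
    (∀ S → S ∈ H → ¬ (S ≡ F) → Even (mult S H))

  module OddPart {𝓕 H : List (Subset n)} (𝓕-unique : Unique 𝓕) (H⊆𝓕 : All (_∈ 𝓕) H) where

    private
      filter-oddPart : ∀ {P : Pred (Subset n) p} (P? : Decidable P) →
        filter P? (oddPart 𝓕 H) ≡ filter (oddMult? H) (filter P? 𝓕)
      filter-oddPart P? = filter-comm P? (oddMult? H) 𝓕

    parity-filter-oddPart : ∀ {P : Pred (Subset n) p} (P? : Decidable P) →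
      parity (length (filter P? H)) ≡ parity (length (filter P? (oddPart 𝓕 H)))
    parity-filter-oddPart P? = begin
      parity (length (filter P? H))                       ≡⟨ cong parity (length-filter≡sum-mult P? 𝓕-unique H⊆𝓕) ⟩
      parity (sum (map (λ T → mult T H) (filter P? 𝓕)))   ≡⟨ parity-sum (λ T → mult T H) (filter P? 𝓕) ⟩
      parity (length (filter (oddMult? H) (filter P? 𝓕))) ≡⟨ cong (parity ∘ length) (filter-oddPart P?) ⟨
      parity (length (filter P? (oddPart 𝓕 H)))           ∎
      where open ≡-Reasoning

    length-filter-oddPart≤ : ∀ {P : Pred (Subset n) p} (P? : Decidable P) →
      length (filter P? (oddPart 𝓕 H)) ≤ length (filter P? H)
    length-filter-oddPart≤ P? = begin
      length (filter P? (oddPart 𝓕 H))           ≡⟨ cong length (filter-oddPart P?) ⟩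
      length (filter (oddMult? H) (filter P? 𝓕)) ≤⟨ length-filter-odd≤sum (λ T → mult T H) (filter P? 𝓕) ⟩
      sum (map (λ T → mult T H) (filter P? 𝓕))   ≡⟨ length-filter≡sum-mult P? 𝓕-unique H⊆𝓕 ⟨
      length (filter P? H)                       ∎
      where open ≤-Reasoning

    parity-degree-oddPart : ∀ x → parity (degree x H) ≡ parity (degree x (oddPart 𝓕 H))
    parity-degree-oddPart x = parity-filter-oddPart (x ∈?_)

    parity-length-oddPart : parity (length H) ≡ parity (length (oddPart 𝓕 H))
    parity-length-oddPart = begin
      parity (length H)                         ≡⟨ cong (parity ∘ length) (filter-all U? (All.universal-U H)) ⟨
      parity (length (filter U? H))             ≡⟨ parity-filter-oddPart U? ⟩
      parity (length (filter U? (oddPart 𝓕 H))) ≡⟨ cong (parity ∘ length) (filter-all U? (All.universal-U (oddPart 𝓕 H))) ⟩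
      parity (length (oddPart 𝓕 H))             ∎
      where open ≡-Reasoning

    oddPart-isOddSunflower : All Nonempty 𝓕 → IsOddSunflower H →
      2 ≤ length (oddPart 𝓕 H) → IsOddSunflower (oddPart 𝓕 H)
    oddPart-isOddSunflower 𝓕-nonempty (_ , _ , H-degrees) 2≤|oddPart| =
      2≤|oddPart| , All.filter⁺ (oddMult? H) 𝓕-nonempty , degrees
      where
      degrees : ∀ x → degree x (oddPart 𝓕 H) ≡ 0 ⊎ Odd (degree x (oddPart 𝓕 H))
      degrees x with H-degrees x
      ... | inj₁ deg≡0 = inj₁ (n≤0⇒n≡0 (subst (degree x (oddPart 𝓕 H) ≤_) deg≡0 (length-filter-oddPart≤ (x ∈?_))))
      ... | inj₂ odd   = inj₂ (odd-resp-parity (parity-degree-oddPart x) odd)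

    oddPart≡singleton : All Nonempty 𝓕 → OddSunflowerFree 𝓕 → IsOddSunflower H →
      ∃[ F ] oddPart 𝓕 H ≡ [ F ]
    oddPart≡singleton 𝓕-nonempty 𝓕-free H-odd with oddPart 𝓕 H in eq
    ... | [] with x , odd ← isOddSunflower⇒∃odd-degree H-odd =
      ⊥-elim (subst (λ L → Odd (degree x L)) eq (odd-resp-parity (parity-degree-oddPart x) odd) (divides 0 refl))
    ... | F ∷ [] = F , refl
    ... | _ ∷ _ ∷ _ = ⊥-elim (𝓕-free (oddPart 𝓕 H) (filter-⊆ (oddMult? H) 𝓕)
      (oddPart-isOddSunflower 𝓕-nonempty H-odd (subst (λ L → 2 ≤ length L) (sym eq) (s≤s (s≤s z≤n)))))

    oddCentre⇒oddPart≡singleton : ∀ {F} → OddCentre 𝓕 H F → oddPart 𝓕 H ≡ [ F ]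
    oddCentre⇒oddPart≡singleton {F} (F∈𝓕 , odd-F , _ , even-others) =
      filter≡singleton (oddMult? H) 𝓕-unique F∈𝓕 odd-F only-F
      where
      only-F : ∀ {T} → T ∈ 𝓕 → Odd (mult T H) → T ≡ F
      only-F {T} _ odd-T = decidable-stable (T ≟S F) λ T≢F →
        odd-T (even-others T (mult>0⇒∈ H (odd⇒>0 odd-T)) T≢F)

    module Singleton {F} (oddPart≡[F] : oddPart 𝓕 H ≡ [ F ]) where

      odd-degree⇔∈ : ∀ x → Odd (degree x H) ⇔ x ∈ₛ F
      odd-degree⇔∈ x = mk⇔
        (Equivalence.to odd-degree-singleton⇔∈ ∘ odd-resp-parity parity-degree≡)
        (odd-resp-parity (sym parity-degree≡) ∘ Equivalence.from odd-degree-singleton⇔∈)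
        where
        parity-degree≡ : parity (degree x H) ≡ parity (degree x [ F ])
        parity-degree≡ = trans (parity-degree-oddPart x) (cong (parity ∘ degree x) oddPart≡[F])

      isOddSunflower⇒⊆ : IsOddSunflower H → ∀ S → S ∈ H → S ⊆ F
      isOddSunflower⇒⊆ H-odd S S∈H {x} x∈S =
        Equivalence.to (odd-degree⇔∈ x) (isOddSunflower⇒odd-degree H-odd S∈H x∈S)

      ⊆⇒isOddSunflower : 2 ≤ length H → All Nonempty 𝓕 → (∀ S → S ∈ H → S ⊆ F) → IsOddSunflower H
      ⊆⇒isOddSunflower 2≤|H| 𝓕-nonempty H⊆F = 2≤|H| , All.map (All.lookup 𝓕-nonempty) H⊆𝓕 , degrees
        where
        degrees : ∀ x → degree x H ≡ 0 ⊎ Odd (degree x H)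
        degrees x with x ∈? F
        ... | yes x∈F = inj₂ (Equivalence.from (odd-degree⇔∈ x) x∈F)
        ... | no  x∉F = inj₁ (cong length (filter-none (x ∈?_) (All.tabulate λ {S} S∈H → x∉F ∘ H⊆F S S∈H)))

      isOddSunflower⇒oddCentre : IsOddSunflower H → OddCentre 𝓕 H F
      isOddSunflower⇒oddCentre H-odd
        with F∈𝓕 , odd-F ← ∈-filter⁻ (oddMult? H) {xs = 𝓕} (subst (F ∈_) (sym oddPart≡[F]) (here refl)) =
        F∈𝓕 , odd-F , isOddSunflower⇒⊆ H-odd , even-others
        where
        even-others : ∀ S → S ∈ H → S ≢ F → Even (mult S H)
        even-others S S∈H S≢F = decidable-stable (2 ∣? mult S H) λ odd-S →
          S≢F (singleton⁻ (subst (S ∈_) oddPart≡[F] (∈-filter⁺ (oddMult? H) (All.lookup H⊆𝓕 S∈H) odd-S)))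

      odd-length : Odd (length H)
      odd-length = odd-resp-parity (trans (cong (parity ∘ length) (sym oddPart≡[F])) (sym parity-length-oddPart)) odd-1

lemma3 : ∀ (n : ℕ) (𝓕 H : List (Subset n)) →
    IsFamily 𝓕 → All Nonempty 𝓕 → OddSunflowerFree 𝓕 →
    2 ≤ length H → All (_∈ 𝓕) H →
    (IsOddSunflower H ⇔
      (∃[ F ] (F ∈ 𝓕 × Odd (mult F H) ×
        (∀ S → S ∈ H → S ⊆ F) ×
        (∀ S → S ∈ H → ¬ (S ≡ F) → Even (mult S H)))))
    × (Even (length H) → ¬ IsOddSunflower H)
lemma3 _ 𝓕 H 𝓕-unique 𝓕-nonempty 𝓕-free 2≤|H| H⊆𝓕 = mk⇔ forward backward , even⇒¬isOddSunflower
  where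
  open OddPart 𝓕-unique H⊆𝓕

  forward : IsOddSunflower H → ∃[ F ] OddCentre 𝓕 H F
  forward H-odd with F , oddPart≡[F] ← oddPart≡singleton 𝓕-nonempty 𝓕-free H-odd =
    F , Singleton.isOddSunflower⇒oddCentre oddPart≡[F] H-odd

  backward : ∃[ F ] OddCentre 𝓕 H F → IsOddSunflower H
  backward (F , centre@(_ , _ , H⊆F , _)) =
    Singleton.⊆⇒isOddSunflower (oddCentre⇒oddPart≡singleton centre) 2≤|H| 𝓕-nonempty H⊆F

  even⇒¬isOddSunflower : Even (length H) → ¬ IsOddSunflower H
  even⇒¬isOddSunflower even H-odd with _ , oddPart≡[F] ← oddPart≡singleton 𝓕-nonempty 𝓕-free H-odd =
    Singleton.odd-length oddPart≡[F] even
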